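{- Let $\mathcal M(q)=(\mathcal P,\mathcal Z)$ be a finite Möbius plane of order $q$, let $S$ be a split-resolving set of minimum cardinality of its point-circle incidence graph, and let $\mathcal Z_S=S\cap\mathcal Z$. If $q>5$, then $2q-3\le|\mathcal Z_S|\le 2q-2$. If $3\le q\le 5$, then $|\mathcal Z_S|=2q-2$.
   Context: A Möbius plane is a pair $(\mathcal P,\mathcal Z)$, where $\mathcal P$ is a set (of points) and $\mathcal Z$ is a set of subsets of $\mathcal P$ (circles), such that: (i) any three pairwise distinct points lie on exactly one circle; (ii) if $z\in\mathcal Z$, $P\in z$ and $Q\in\mathcal P\setminus z$, there is exactly one circle $z'$ through $P$ and $Q$ with $z\cap z'=\{P\}$; (iii) there is at least one circle and every circle has at least three points; (iv) for every circle $z$ there is a point not on $z$. It is finite if $\mathcal P$ is finite; then all circles have the same number $q+1$ of points, and $q$ is the order. The point-circle incidence graph has vertex set $\mathcal P\cup\mathcal Z$ and edges $\{P,z\}$ with $P\in z$, with shortest-path distance $d$. A set $S$ resolves $W$ if for any two distinct $u,v\in W$ there is $s\in S$ with $d(u,s)\ne d(v,s)$. A set $S\subseteq\mathcal P\cup\mathcal Z$ is split-resolving if $S\cap\mathcal P$ resolves $\mathcal Z$ and $S\cap\mathcal Z$ resolves $\mathcal P$. -}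

module Defs where

open import Data.Nat using (ℕ; zero; suc; _≤_; _<_; _+_)
open import Data.Fin using (Fin)
open import Data.Fin.Subset using (Subset; _∈_; _∉_; ∣_∣)
open import Data.Sum using (_⊎_; inj₁; inj₂)
open import Data.Product using (Σ; _×_; _,_; ∃)
open import Relation.Binary.PropositionalEquality using (_≡_; _≢_)
open import Relation.Nullary using (¬_)
open import Data.Empty using (⊥)

record MoebiusPlane (nP nZ : ℕ) : Set where
  field
    circle : Fin nZ → Subset nP
    -- circles are distinct subsets (Z is a *set* of subsets)
    circle-injective : ∀ z z′ → (∀ P → (P ∈ circle z → P ∈ circle z′) × (P ∈ circle z′ → P ∈ circle z)) → z ≡ z′
    axiom-i : ∀ P Q R → P ≢ Q → P ≢ R → Q ≢ R →
      Σ (Fin nZ) λ z → (P ∈ circle z × Q ∈ circle z × R ∈ circle z) ×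
        (∀ z′ → P ∈ circle z′ → Q ∈ circle z′ → R ∈ circle z′ → z′ ≡ z)
    axiom-ii : ∀ z P Q → P ∈ circle z → Q ∉ circle z →
      Σ (Fin nZ) λ z′ → (P ∈ circle z′ × Q ∈ circle z′ × (∀ X → X ∈ circle z → X ∈ circle z′ → X ≡ P)) ×
        (∀ z″ → P ∈ circle z″ → Q ∈ circle z″ → (∀ X → X ∈ circle z → X ∈ circle z″ → X ≡ P) → z″ ≡ z′)
    axiom-iii-nonempty : Fin nZ
    axiom-iii-size : ∀ z → 3 ≤ ∣ circle z ∣
    axiom-iv : ∀ z → ∃ λ P → P ∉ circle z

module _ {nP nZ : ℕ} (M : MoebiusPlane nP nZ) where
  open MoebiusPlane M

  HasOrder : ℕ → Set
  HasOrder q = ∀ z → ∣ circle z ∣ ≡ suc q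

  Vertex : Set
  Vertex = Fin nP ⊎ Fin nZ

  Adj : Vertex → Vertex → Set
  Adj (inj₁ P) (inj₁ Q) = ⊥
  Adj (inj₁ P) (inj₂ z) = P ∈ circle z
  Adj (inj₂ z) (inj₁ P) = P ∈ circle z
  Adj (inj₂ z) (inj₂ z′) = ⊥

  Walk : ℕ → Vertex → Vertex → Set
  Walk zero u v = u ≡ v
  Walk (suc k) u v = Σ Vertex λ w → Adj u w × Walk k w v

  IsDist : Vertex → Vertex → ℕ → Set
  IsDist u v k = Walk k u v × (∀ j → j < k → ¬ Walk j u v)

  Separates : Vertex → Vertex → Vertex → Set
  Separates s u v = Σ ℕ λ k₁ → Σ ℕ λ k₂ → IsDist u s k₁ × IsDist v s k₂ × k₁ ≢ k₂

  -- split-resolving set S = SP ∪ SZ, SP ⊆ points, SZ ⊆ circles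
  SplitResolving : Subset nP → Subset nZ → Set
  SplitResolving SP SZ =
    (∀ z z′ → z ≢ z′ → Σ (Fin nP) λ P → P ∈ SP × Separates (inj₁ P) (inj₂ z) (inj₂ z′)) ×
    (∀ P Q → P ≢ Q → Σ (Fin nZ) λ z → z ∈ SZ × Separates (inj₂ z) (inj₁ P) (inj₁ Q))

  MinSplitResolving : Subset nP → Subset nZ → Set
  MinSplitResolving SP SZ = SplitResolving SP SZ ×
    (∀ SP′ SZ′ → SplitResolving SP′ SZ′ → ∣ SP ∣ + ∣ SZ ∣ ≤ ∣ SP′ ∣ + ∣ SZ′ ∣)

{-# OPTIONS --safe #-}
-- Fix circles c₁ ≠ c₂ through points ∞ ≠ A. The circles through ∞ touching c₁ there form, with c₁,
-- a pencil covering every point other than ∞ exactly once; it has at least q members (one through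
-- each point of c₂ other than ∞), so there are at least q² + 1 points.
-- A point is at distance 1 or 3 from a circle, so circles resolve two points exactly when one of
-- them passes through exactly one of the points. If the circles of S resolve all points, at most
-- one point lies on no circle of S and at most |S| points lie on exactly one; double counting
-- incidences gives 2(q² + 1) ≤ (q + 1)|S| + 2 + |S|, i.e. 2q² ≤ (q + 2)|S|, so |S| ≥ 2q − 3, and
-- |S| ≥ 2q − 2 when q ≤ 5.
-- Conversely, for q ≥ 3 the circles touching c₁ or c₂ at ∞ resolve all points. There are at most
-- q − 1 of each kind, since each meets the other circle in a second point other than A; swapping
-- them in for the circles of a minimum split-resolving set gives |𝒵_S| ≤ 2q − 2.
module Submission where

open import Defs
open import Data.Nat using (ℕ; zero; suc; _+_; _*_; _∸_; _≤_; _<_; z≤n; s≤s; _≤?_)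
  renaming (_≟_ to _≟ℕ_)
open import Data.Nat.Properties
  using ( ≤-refl; ≤-trans; ≤-antisym; ≤-pred; <-irrefl; <-cmp; ≰⇒>; >⇒≢; module ≤-Reasoning
        ; +-identityʳ; +-comm; *-comm; *-suc; *-distribˡ-+; +-mono-≤; +-monoˡ-≤; +-monoʳ-≤; +-monoʳ-<
        ; *-monoˡ-≤; *-monoʳ-≤; *-monoʳ-<; +-cancelˡ-≤; m≤m+n; m≤n+m; m<m+n
        ; m≤n+o⇒m∸n≤o; m+n≤o⇒m≤o∸n; +-suc; suc-injective; +-*-semiring)
open import Data.Nat.Tactic.RingSolver using (solve-∀)
open import Data.Bool using (Bool; true; false; _∧_)
open import Data.Fin using (Fin; zero; suc)
open import Data.Fin.Properties using (_≟_; all?; any?; 0≢1+n)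
import Data.Fin.Properties as Fin
open import Data.Fin.Subset using (Subset; inside; outside; _∈_; _∉_; ∣_∣; Nonempty; ⊤; ⁅_⁆; _∩_; _∪_; _-_)
open import Data.Fin.Subset.Properties
  using ( _∈?_; ∈⊤; x∈⁅x⁆; ∣⊤∣≡n; ∣⊥∣≡0; ∣⁅x⁆∣≡1; ∣p∣≤∣x∷p∣; ∣p∩q∣≤∣p∣; p─⊥≡p; p─q⊆p; nonempty?; Empty-unique
        ; x∈p∩q⁺; x∈p∩q⁻; x∈p∪q⁺; x∈p∧x≢y⇒x∈p-y)
open import Data.Vec using (_∷_; []; lookup; tabulate; here; there)
open import Data.Vec.Properties using (lookup∘tabulate; lookup-zipWith; []=⇒lookup; lookup⇒[]=)
open import Data.Product using (∃-syntax; _×_; _,_; proj₁; proj₂; map₁; map₂)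
open import Data.Sum using (_⊎_; inj₁; inj₂; [_,_])
open import Data.Empty using (⊥)
open import Function using (_∘_)
open import Level using (Level)
open import Relation.Binary using (tri<; tri≈; tri>)
open import Relation.Binary.PropositionalEquality using (_≡_; _≢_; refl; sym; trans; cong; cong₂; subst; module ≡-Reasoning)
open import Relation.Nullary using (Dec; yes; no; does; ¬_; contradiction)
open import Relation.Nullary.Decidable using (dec-true; dec-false; decidable-stable; _×-dec_; _⊎-dec_; _→-dec_; ¬?)
open import Relation.Unary using (Pred; Decidable)
open import Algebra.Properties.Semiring.Sum +-*-semiring
  using (sum; sum-syntax; sum-cong-≗; ∑-comm; ∑-distrib-+; *-distribˡ-sum; *-distribʳ-sum)

private variable
  ℓ : Level
  m n : ℕ
  p : Subset n
  x y : Fin n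

⟪_⟫ : {P : Pred (Fin n) ℓ} → Decidable P → Subset n
⟪ P? ⟫ = tabulate (does ∘ P?)

module _ {P : Pred (Fin n) ℓ} (P? : Decidable P) where

  lookup-⟪⟫ : ∀ x → lookup ⟪ P? ⟫ x ≡ does (P? x)
  lookup-⟪⟫ = lookup∘tabulate (does ∘ P?)

  ∈⟪⟫⁺ : P x → x ∈ ⟪ P? ⟫
  ∈⟪⟫⁺ {x} px = lookup⇒[]= x ⟪ P? ⟫ (trans (lookup-⟪⟫ x) (dec-true (P? x) px))

  ∈⟪⟫⁻ : x ∈ ⟪ P? ⟫ → P x
  ∈⟪⟫⁻ {x} x∈⟪P⟫ = decidable-stable (P? x) λ ¬px → false≢true (begin
      false             ≡⟨ sym (dec-false (P? x) ¬px) ⟩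
      does (P? x)       ≡⟨ sym (lookup-⟪⟫ x) ⟩
      lookup ⟪ P? ⟫ x   ≡⟨ []=⇒lookup x∈⟪P⟫ ⟩
      true              ∎)
    where
    open ≡-Reasoning
    false≢true : false ≢ true
    false≢true ()

x∉p-x : ∀ (x : Fin n) → x ∉ p - x
x∉p-x {p = _ ∷ _} zero    ()
x∉p-x {p = _ ∷ _} (suc x) (there x∈p-x) = x∉p-x x x∈p-x

x∈p-y⁻ : x ∈ p - y → x ∈ p × x ≢ y
x∈p-y⁻ {p = p} {y} x∈p-y = p─q⊆p p ⁅ y ⁆ x∈p-y , λ { refl → x∉p-x y x∈p-y }

∣p∣≡1+∣p-x∣ : x ∈ p → ∣ p ∣ ≡ suc ∣ p - x ∣
∣p∣≡1+∣p-x∣ {x = zero}  {p = inside  ∷ p} here        = cong (suc ∘ ∣_∣) (sym (p─⊥≡p p))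
∣p∣≡1+∣p-x∣ {x = suc x} {p = outside ∷ p} (there x∈p) = ∣p∣≡1+∣p-x∣ x∈p
∣p∣≡1+∣p-x∣ {x = suc x} {p = inside  ∷ p} (there x∈p) = cong suc (∣p∣≡1+∣p-x∣ x∈p)

x∈p⇒0<∣p∣ : x ∈ p → 0 < ∣ p ∣
x∈p⇒0<∣p∣ x∈p rewrite ∣p∣≡1+∣p-x∣ x∈p = s≤s z≤n

x∈p⇒y∈p⇒x≢y⇒1<∣p∣ : x ∈ p → y ∈ p → x ≢ y → 1 < ∣ p ∣
x∈p⇒y∈p⇒x≢y⇒1<∣p∣ x∈p y∈p x≢y rewrite ∣p∣≡1+∣p-x∣ x∈p =
  s≤s (x∈p⇒0<∣p∣ (x∈p∧x≢y⇒x∈p-y y∈p (x≢y ∘ sym)))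

0<∣p∣⇒Nonempty : 0 < ∣ p ∣ → Nonempty p
0<∣p∣⇒Nonempty {n} {p} 0<∣p∣ with nonempty? p
... | yes nonempty = nonempty
... | no  empty    = contradiction (trans (cong ∣_∣ (Empty-unique empty)) (∣⊥∣≡0 n)) (>⇒≢ 0<∣p∣)

∣p∪r∣≤∣p∣+∣r∣ : ∀ (p r : Subset n) → ∣ p ∪ r ∣ ≤ ∣ p ∣ + ∣ r ∣
∣p∪r∣≤∣p∣+∣r∣ []            []            = z≤n
∣p∪r∣≤∣p∣+∣r∣ (outside ∷ p) (outside ∷ r) = ∣p∪r∣≤∣p∣+∣r∣ p r
∣p∪r∣≤∣p∣+∣r∣ (outside ∷ p) (inside  ∷ r) =
  subst (suc ∣ p ∪ r ∣ ≤_) (sym (+-suc ∣ p ∣ ∣ r ∣)) (s≤s (∣p∪r∣≤∣p∣+∣r∣ p r))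
∣p∪r∣≤∣p∣+∣r∣ (inside  ∷ p) (s ∷ r) =
  s≤s (≤-trans (∣p∪r∣≤∣p∣+∣r∣ p r) (+-monoʳ-≤ ∣ p ∣ (∣p∣≤∣x∷p∣ s r)))

injective⇒∣p∣≤∣r∣ : {p : Subset n} {r : Subset m} (f : ∀ {x} → x ∈ p → Fin m) →
  (∀ {x} (x∈p : x ∈ p) → f x∈p ∈ r) →
  (∀ {x y} (x∈p : x ∈ p) (y∈p : y ∈ p) → f x∈p ≡ f y∈p → x ≡ y) → ∣ p ∣ ≤ ∣ r ∣
injective⇒∣p∣≤∣r∣ {p = []} f f∈r f-inj = z≤n
injective⇒∣p∣≤∣r∣ {p = outside ∷ p} f f∈r f-inj =
  injective⇒∣p∣≤∣r∣ (f ∘ there) (f∈r ∘ there) λ x∈p y∈p e → Fin.suc-injective (f-inj (there x∈p) (there y∈p) e)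
injective⇒∣p∣≤∣r∣ {p = inside ∷ p} f f∈r f-inj rewrite ∣p∣≡1+∣p-x∣ (f∈r here) =
  s≤s (injective⇒∣p∣≤∣r∣ (f ∘ there)
    (λ x∈p → x∈p∧x≢y⇒x∈p-y (f∈r (there x∈p)) λ e → 0≢1+n (f-inj here (there x∈p) (sym e)))
    λ x∈p y∈p e → Fin.suc-injective (f-inj (there x∈p) (there y∈p) e))

all-equal⇒∣p∣≤1 : (∀ {x y} → x ∈ p → y ∈ p → x ≡ y) → ∣ p ∣ ≤ 1
all-equal⇒∣p∣≤1 all-equal = injective⇒∣p∣≤∣r∣ {r = ⊤ {1}} (λ _ → zero) (λ _ → here) λ x∈p y∈p _ → all-equal x∈p y∈p

indicator : Bool → ℕ
indicator true  = 1
indicator false = 0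

indicator-∧ : ∀ a b → indicator (a ∧ b) ≡ indicator a * indicator b
indicator-∧ true  b = sym (+-identityʳ (indicator b))
indicator-∧ false b = refl

deficit : ℕ → ℕ
deficit d = 2 * indicator (does (d ≟ℕ 0)) + indicator (does (d ≟ℕ 1))

2≤d+deficit[d] : ∀ d → 2 ≤ d + deficit d
2≤d+deficit[d] 0             = ≤-refl
2≤d+deficit[d] 1             = ≤-refl
2≤d+deficit[d] (suc (suc d)) = s≤s (s≤s z≤n)

∣p∣≡∑ : ∀ (p : Subset n) → ∣ p ∣ ≡ ∑[ x < n ] indicator (lookup p x)
∣p∣≡∑ []            = refl
∣p∣≡∑ (inside  ∷ p) = cong suc (∣p∣≡∑ p)
∣p∣≡∑ (outside ∷ p) = ∣p∣≡∑ p

∑-const : ∀ n k → ∑[ x < n ] k ≡ n * k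
∑-const zero    k = refl
∑-const (suc n) k = cong (k +_) (∑-const n k)

∑-mono-≤ : ∀ {f g : Fin n → ℕ} → (∀ x → f x ≤ g x) → sum f ≤ sum g
∑-mono-≤ {zero}  f≤g = z≤n
∑-mono-≤ {suc n} f≤g = +-mono-≤ (f≤g zero) (∑-mono-≤ (f≤g ∘ suc))

dual : (Fin m → Subset n) → Fin n → Subset m
dual block x = tabulate (λ c → lookup (block c) x)

module _ {block : Fin m → Subset n} {c : Fin m} where

  ∈dual⁺ : x ∈ block c → c ∈ dual block x
  ∈dual⁺ {x} x∈c = lookup⇒[]= c (dual block x) (trans (lookup∘tabulate _ c) ([]=⇒lookup x∈c))

  ∈dual⁻ : c ∈ dual block x → x ∈ block c
  ∈dual⁻ {x} c∈x = lookup⇒[]= x (block c) (trans (sym (lookup∘tabulate _ c)) ([]=⇒lookup c∈x))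

∑∣S∩dual∣≡∣S∣*k : ∀ (S : Subset m) (block : Fin m → Subset n) {k} → (∀ c → ∣ block c ∣ ≡ k) →
  ∑[ x < n ] ∣ S ∩ dual block x ∣ ≡ ∣ S ∣ * k
∑∣S∩dual∣≡∣S∣*k {m} {n} S block {k} ∣block∣≡k = begin
  ∑[ x < n ] ∣ S ∩ dual block x ∣     ≡⟨ sum-cong-≗ incidences ⟩
  ∑[ x < n ] ∑[ c < m ] (χS c * χ c x) ≡⟨ ∑-comm (λ x c → χS c * χ c x) ⟩
  ∑[ c < m ] ∑[ x < n ] (χS c * χ c x) ≡⟨ sum-cong-≗ (λ c → sym (*-distribˡ-sum (χS c) (χ c))) ⟩
  ∑[ c < m ] (χS c * ∑[ x < n ] χ c x) ≡⟨ sum-cong-≗ (λ c → cong (χS c *_) (trans (sym (∣p∣≡∑ (block c))) (∣block∣≡k c))) ⟩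
  ∑[ c < m ] (χS c * k)                ≡⟨ sym (*-distribʳ-sum k χS) ⟩
  (∑[ c < m ] χS c) * k                ≡⟨ cong (_* k) (sym (∣p∣≡∑ S)) ⟩
  ∣ S ∣ * k                            ∎
  where
  open ≡-Reasoning
  χS : Fin m → ℕ
  χS c = indicator (lookup S c)
  χ : Fin m → Fin n → ℕ
  χ c x = indicator (lookup (block c) x)
  incidences : ∀ x → ∣ S ∩ dual block x ∣ ≡ ∑[ c < m ] (χS c * χ c x)
  incidences x = trans (∣p∣≡∑ (S ∩ dual block x)) (sum-cong-≗ λ c →
    trans (cong indicator (trans (lookup-zipWith _∧_ c S (dual block x))
                                 (cong (lookup S c ∧_) (lookup∘tabulate (λ c → lookup (block c) x) c))))
          (indicator-∧ (lookup S c) (lookup (block c) x)))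

m<o⇒n<o⇒m+n≤2o∸2 : ∀ {m n o} → m < o → n < o → m + n ≤ 2 * o ∸ 2
m<o⇒n<o⇒m+n≤2o∸2 {m} {n} {o} m<o n<o = m+n≤o⇒m≤o∸n (m + n) (begin
  m + n + 2      ≡⟨ shift m n ⟩
  suc m + suc n  ≤⟨ +-mono-≤ m<o n<o ⟩
  o + o          ≡⟨ cong (o +_) (sym (+-identityʳ o)) ⟩
  2 * o          ∎)
  where
  open ≤-Reasoning
  shift : ∀ m n → m + n + 2 ≡ suc m + suc n
  shift = solve-∀

4q<4[q+2] : ∀ q → 4 * q < 4 * (q + 2)
4q<4[q+2] q = *-monoʳ-< 4 (m<m+n q (s≤s z≤n))

q≤5⇒4q<3[q+2] : ∀ {q} → q ≤ 5 → 4 * q < 3 * (q + 2)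
q≤5⇒4q<3[q+2] {q} q≤5 = begin-strict
  4 * q      ≡⟨ +-comm q (3 * q) ⟩
  3 * q + q  <⟨ +-monoʳ-< (3 * q) (s≤s q≤5) ⟩
  3 * q + 6  ≡⟨ sym (*-distribˡ-+ 3 q 2) ⟩
  3 * (q + 2) ∎
  where open ≤-Reasoning

2q∸j≤k : ∀ {q k} j → 2 * (q * q) ≤ k * (q + 2) → 4 * q < suc j * (q + 2) → 2 * q ∸ j ≤ k
2q∸j≤k {q} {k} j 2q²≤k[q+2] 4q<[1+j][q+2] with 2 * q ≤? j + k
... | yes 2q≤j+k = m≤n+o⇒m∸n≤o (2 * q) j 2q≤j+k
... | no  2q≰j+k = contradiction 2q[q+2]<2q[q+2] (<-irrefl refl)
  where
  open ≤-Reasoning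
  expand : ∀ q → 2 * q * (q + 2) ≡ 2 * (q * q) + 4 * q
  expand = solve-∀
  regroup : ∀ j k q → k * (q + 2) + suc j * (q + 2) ≡ suc (j + k) * (q + 2)
  regroup = solve-∀
  2q[q+2]<2q[q+2] : 2 * q * (q + 2) < 2 * q * (q + 2)
  2q[q+2]<2q[q+2] = begin-strict
    2 * q * (q + 2)               ≡⟨ expand q ⟩
    2 * (q * q) + 4 * q           <⟨ +-monoʳ-< (2 * (q * q)) 4q<[1+j][q+2] ⟩
    2 * (q * q) + suc j * (q + 2) ≤⟨ +-monoˡ-≤ (suc j * (q + 2)) 2q²≤k[q+2] ⟩
    k * (q + 2) + suc j * (q + 2) ≡⟨ regroup j k q ⟩
    suc (j + k) * (q + 2)         ≤⟨ *-monoˡ-≤ (q + 2) (≰⇒> 2q≰j+k) ⟩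
    2 * q * (q + 2)               ∎

module Incidence {nP nZ : ℕ} (M : MoebiusPlane nP nZ) where
  open MoebiusPlane M

  private variable
    X Y : Fin nP
    z : Fin nZ

  Splits : Fin nZ → Fin nP → Fin nP → Set
  Splits z X Y = X ∈ circle z × Y ∉ circle z ⊎ X ∉ circle z × Y ∈ circle z

  Splits-sym : Splits z X Y → Splits z Y X
  Splits-sym (inj₁ (X∈z , Y∉z)) = inj₂ (Y∉z , X∈z)
  Splits-sym (inj₂ (X∉z , Y∈z)) = inj₁ (Y∈z , X∉z)

  Splitting : Subset nZ → Set
  Splitting S = ∀ X Y → X ≢ Y → ∃[ z ] z ∈ S × Splits z X Y

  circle-unique : ∀ {W a b} → X ≢ Y → X ≢ W → Y ≢ W →
    X ∈ circle a → Y ∈ circle a → W ∈ circle a → X ∈ circle b → Y ∈ circle b → W ∈ circle b → a ≡ b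
  circle-unique X≢Y X≢W Y≢W Xa Ya Wa Xb Yb Wb =
    let (_ , _ , unique) = axiom-i _ _ _ X≢Y X≢W Y≢W in trans (unique _ Xa Ya Wa) (sym (unique _ Xb Yb Wb))

  circle-nonempty : ∀ z → Nonempty (circle z)
  circle-nonempty z = 0<∣p∣⇒Nonempty (≤-trans (s≤s z≤n) (axiom-iii-size z))

  dist-unique : ∀ {u v k₁ k₂} → IsDist M u v k₁ → IsDist M u v k₂ → k₁ ≡ k₂
  dist-unique {k₁ = k₁} {k₂} (walk₁ , shortest₁) (walk₂ , shortest₂) with <-cmp k₁ k₂
  ... | tri< k₁<k₂ _ _ = contradiction walk₁ (shortest₂ k₁ k₁<k₂)
  ... | tri≈ _ k₁≡k₂ _ = k₁≡k₂
  ... | tri> _ _ k₂<k₁ = contradiction walk₂ (shortest₁ k₂ k₂<k₁)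

  dist-on : X ∈ circle z → IsDist M (inj₁ X) (inj₂ z) 1
  dist-on {z = z} X∈z = (inj₂ z , X∈z , refl) , λ { zero _ () ; (suc _) (s≤s ()) }

  -- The walk leaves X along the circle touching z at some point Y of z.
  dist-off : X ∉ circle z → IsDist M (inj₁ X) (inj₂ z) 3
  dist-off {X} {z} X∉z = walk , shortest
    where
    walk : Walk M 3 (inj₁ X) (inj₂ z)
    walk = let (Y , Y∈z) = circle-nonempty z
               (c , (Y∈c , X∈c , _) , _) = axiom-ii z Y X Y∈z X∉z
           in inj₂ c , X∈c , inj₁ Y , Y∈c , inj₂ z , Y∈z , refl
    shortest : ∀ j → j < 3 → ¬ Walk M j (inj₁ X) (inj₂ z)
    shortest 0 _ ()
    shortest 1 _ (inj₂ _ , X∈z , refl) = X∉z X∈z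
    shortest 2 _ (inj₂ _ , _ , inj₁ _ , _ , ())
    shortest (suc (suc (suc _))) (s≤s (s≤s (s≤s ())))

  separates⇒splits : Separates M (inj₂ z) (inj₁ X) (inj₁ Y) → Splits z X Y
  separates⇒splits {z} {X} {Y} (_ , _ , dX , dY , k₁≢k₂) with X ∈? circle z | Y ∈? circle z
  ... | yes X∈z | yes Y∈z = contradiction (trans (dist-unique dX (dist-on X∈z)) (dist-unique (dist-on Y∈z) dY)) k₁≢k₂
  ... | no  X∉z | no  Y∉z = contradiction (trans (dist-unique dX (dist-off X∉z)) (dist-unique (dist-off Y∉z) dY)) k₁≢k₂
  ... | yes X∈z | no  Y∉z = inj₁ (X∈z , Y∉z)
  ... | no  X∉z | yes Y∈z = inj₂ (X∉z , Y∈z)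

  splits⇒separates : Splits z X Y → Separates M (inj₂ z) (inj₁ X) (inj₁ Y)
  splits⇒separates (inj₁ (X∈z , Y∉z)) = 1 , 3 , dist-on X∈z , dist-off Y∉z , λ ()
  splits⇒separates (inj₂ (X∉z , Y∈z)) = 3 , 1 , dist-off X∉z , dist-on Y∈z , λ ()

  record Frame : Set where
    field
      ∞ A     : Fin nP
      c₁ c₂   : Fin nZ
      ∞≢A     : ∞ ≢ A
      c₁≢c₂   : c₁ ≢ c₂
      ∞∈c₁    : ∞ ∈ circle c₁
      A∈c₁    : A ∈ circle c₁
      ∞∈c₂    : ∞ ∈ circle c₂
      A∈c₂    : A ∈ circle c₂

  swap : Frame → Frame
  swap fr = record
    { ∞ = ∞ ; A = A ; c₁ = c₂ ; c₂ = c₁ ; ∞≢A = ∞≢A ; c₁≢c₂ = c₁≢c₂ ∘ sym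
    ; ∞∈c₁ = ∞∈c₂ ; A∈c₁ = A∈c₂ ; ∞∈c₂ = ∞∈c₁ ; A∈c₂ = A∈c₁ }
    where open Frame fr

  someFrame : Frame
  someFrame =
    let c₁             = axiom-iii-nonempty
        (∞ , ∞∈c₁)     = circle-nonempty c₁
        (A , A∈c₁-∞)   = 0<∣p∣⇒Nonempty (≤-trans (s≤s z≤n) (≤-pred (subst (3 ≤_) (∣p∣≡1+∣p-x∣ ∞∈c₁) (axiom-iii-size c₁))))
        (A∈c₁ , A≢∞)   = x∈p-y⁻ A∈c₁-∞
        (D , D∉c₁)     = axiom-iv c₁
        ≢D             = λ {X} (X∈c₁ : X ∈ circle c₁) X≡D → D∉c₁ (subst (λ Y → Y ∈ circle c₁) X≡D X∈c₁)
        (c₂ , (∞∈c₂ , A∈c₂ , D∈c₂) , _) = axiom-i ∞ A D (A≢∞ ∘ sym) (≢D ∞∈c₁) (≢D A∈c₁)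
    in record
      { ∞ = ∞ ; A = A ; c₁ = c₁ ; c₂ = c₂ ; ∞≢A = A≢∞ ∘ sym
      ; c₁≢c₂ = λ c₁≡c₂ → D∉c₁ (subst (λ c → D ∈ circle c) (sym c₁≡c₂) D∈c₂)
      ; ∞∈c₁ = ∞∈c₁ ; A∈c₁ = A∈c₁ ; ∞∈c₂ = ∞∈c₂ ; A∈c₂ = A∈c₂ }

  -- In the affine plane derived at ∞, pencil is the parallel class of c₁ and line X its member through X.
  module Pencil (fr : Frame) where
    open Frame fr

    Touches : Fin nZ → Set
    Touches z = ∞ ∈ circle z × (∀ X → X ∈ circle z → X ∈ circle c₁ → X ≡ ∞)

    InPencil : Fin nZ → Set
    InPencil z = z ≡ c₁ ⊎ Touches z

    touches? : Decidable Touches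
    touches? z = ∞ ∈? circle z ×-dec all? λ X → X ∈? circle z →-dec (X ∈? circle c₁ →-dec X ≟ ∞)

    inPencil? : Decidable InPencil
    inPencil? z = z ≟ c₁ ⊎-dec touches? z

    touching pencil : Subset nZ
    touching = ⟪ touches? ⟫
    pencil   = ⟪ inPencil? ⟫

    c₂° : Subset nP
    c₂° = circle c₂ - ∞ - A

    ∈c₂°⁻ : X ∈ c₂° → X ∈ circle c₂ × X ≢ ∞ × X ≢ A
    ∈c₂°⁻ X∈c₂° = let (X∈c₂-∞ , X≢A) = x∈p-y⁻ X∈c₂° ; (X∈c₂ , X≢∞) = x∈p-y⁻ X∈c₂-∞ in X∈c₂ , X≢∞ , X≢A

    InPencil⇒∞∈ : InPencil z → ∞ ∈ circle z
    InPencil⇒∞∈ (inj₁ refl)    = ∞∈c₁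
    InPencil⇒∞∈ (inj₂ touches) = proj₁ touches

    A∉touching : Touches z → A ∉ circle z
    A∉touching (_ , z∩c₁⊆∞) A∈z = ∞≢A (sym (z∩c₁⊆∞ A A∈z A∈c₁))

    c₂∉pencil : ¬ InPencil c₂
    c₂∉pencil (inj₁ c₂≡c₁) = c₁≢c₂ (sym c₂≡c₁)
    c₂∉pencil (inj₂ touches) = A∉touching touches A∈c₂

    -- c₁ and c₂ would both be the circle through A touching z at ∞.
    touching⇒¬touches-c₂ : Touches z → ¬ (∀ X → X ∈ circle z → X ∈ circle c₂ → X ≡ ∞)
    touching⇒¬touches-c₂ touches@(∞∈z , z∩c₁⊆∞) z∩c₂⊆∞ =
      let (_ , _ , unique) = axiom-ii _ ∞ A ∞∈z (A∉touching touches)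
      in c₁≢c₂ (trans (unique c₁ ∞∈c₁ A∈c₁ z∩c₁⊆∞) (sym (unique c₂ ∞∈c₂ A∈c₂ z∩c₂⊆∞)))

    touching-meets-c₂ : Touches z → ∃[ X ] X ∈ circle z × X ∈ circle c₂ × X ≢ ∞
    touching-meets-c₂ {z} touches with any? (λ X → X ∈? circle z ×-dec (X ∈? circle c₂ ×-dec ¬? (X ≟ ∞)))
    ... | yes meets = meets
    ... | no ¬meets = contradiction
      (λ X X∈z X∈c₂ → decidable-stable (X ≟ ∞) λ X≢∞ → ¬meets (X , X∈z , X∈c₂ , X≢∞))
      (touching⇒¬touches-c₂ touches)

    -- The decision is an argument so that lemmas about line can case on it.
    lineThrough : ∀ X → Dec (X ∈ circle c₁) → Fin nZ
    lineThrough X (yes _)    = c₁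
    lineThrough X (no X∉c₁) = proj₁ (axiom-ii c₁ ∞ X ∞∈c₁ X∉c₁)

    line : Fin nP → Fin nZ
    line X = lineThrough X (X ∈? circle c₁)

    lineThrough-spec : ∀ X d → InPencil (lineThrough X d) × X ∈ circle (lineThrough X d)
    lineThrough-spec X (yes X∈c₁) = inj₁ refl , X∈c₁
    lineThrough-spec X (no X∉c₁) =
      let (_ , (∞∈z , X∈z , c₁∩z⊆∞) , _) = axiom-ii c₁ ∞ X ∞∈c₁ X∉c₁
      in inj₂ (∞∈z , λ Y Y∈z Y∈c₁ → c₁∩z⊆∞ Y Y∈c₁ Y∈z) , X∈z

    lineThrough-unique : ∀ X d → InPencil z → X ∈ circle z → X ≢ ∞ → z ≡ lineThrough X d
    lineThrough-unique X (yes _)    (inj₁ refl) _ _ = refl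
    lineThrough-unique X (yes X∈c₁) (inj₂ (_ , z∩c₁⊆∞)) X∈z X≢∞ = contradiction (z∩c₁⊆∞ X X∈z X∈c₁) X≢∞
    lineThrough-unique X (no X∉c₁)  (inj₁ refl) X∈z _ = contradiction X∈z X∉c₁
    lineThrough-unique X (no X∉c₁)  (inj₂ (∞∈z , z∩c₁⊆∞)) X∈z _ =
      proj₂ (proj₂ (axiom-ii c₁ ∞ X ∞∈c₁ X∉c₁)) _ ∞∈z X∈z λ Y Y∈c₁ Y∈z → z∩c₁⊆∞ Y Y∈z Y∈c₁

    line∈pencil : ∀ X → InPencil (line X)
    line∈pencil X = proj₁ (lineThrough-spec X (X ∈? circle c₁))

    ∈line : ∀ X → X ∈ circle (line X)
    ∈line X = proj₂ (lineThrough-spec X (X ∈? circle c₁))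

    line-unique : InPencil z → X ∈ circle z → X ≢ ∞ → z ≡ line X
    line-unique {X = X} = lineThrough-unique X (X ∈? circle c₁)

    line≡⇒∈line : line X ≡ line Y → Y ∈ circle (line X)
    line≡⇒∈line {Y = Y} lineX≡lineY = subst (λ z → Y ∈ circle z) (sym lineX≡lineY) (∈line Y)

    ∉line : InPencil z → z ≢ line Y → Y ≢ ∞ → Y ∉ circle z
    ∉line inPencil z≢lineY Y≢∞ Y∈z = z≢lineY (line-unique inPencil Y∈z Y≢∞)

    line-injective-on-c₂ : X ∈ circle c₂ → Y ∈ circle c₂ → X ≢ ∞ → Y ≢ ∞ → line X ≡ line Y → X ≡ Y
    line-injective-on-c₂ {X} {Y} X∈c₂ Y∈c₂ X≢∞ Y≢∞ lineX≡lineY = decidable-stable (X ≟ Y) λ X≢Y →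
      c₂∉pencil (subst InPencil
        (circle-unique (X≢∞ ∘ sym) (Y≢∞ ∘ sym) X≢Y (InPencil⇒∞∈ (line∈pencil X)) (∈line X) (line≡⇒∈line {X} lineX≡lineY)
          ∞∈c₂ X∈c₂ Y∈c₂)
        (line∈pencil X))

    line-touches : X ∈ c₂° → Touches (line X)
    line-touches {X} X∈c₂° with line∈pencil X | ∈c₂°⁻ X∈c₂°
    ... | inj₂ touches | _ = touches
    ... | inj₁ lineX≡c₁ | X∈c₂ , X≢∞ , X≢A = contradiction
      (circle-unique ∞≢A (X≢∞ ∘ sym) (X≢A ∘ sym) ∞∈c₁ A∈c₁ (subst (λ z → X ∈ circle z) lineX≡c₁ (∈line X)) ∞∈c₂ A∈c₂ X∈c₂)
      c₁≢c₂

    touching-splits : X ≢ ∞ → Y ≢ ∞ → line X ≢ line Y → ∃[ z ] z ∈ touching × Splits z X Y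
    touching-splits {X} {Y} X≢∞ Y≢∞ lineX≢lineY with line∈pencil X | line∈pencil Y
    ... | inj₂ touches | _ =
      line X , ∈⟪⟫⁺ touches? touches , inj₁ (∈line X , ∉line (inj₂ touches) lineX≢lineY Y≢∞)
    ... | inj₁ _ | inj₂ touches =
      line Y , ∈⟪⟫⁺ touches? touches , inj₂ (∉line (inj₂ touches) (lineX≢lineY ∘ sym) X≢∞ , ∈line Y)
    ... | inj₁ lineX≡c₁ | inj₁ lineY≡c₁ = contradiction (trans lineX≡c₁ (sym lineY≡c₁)) lineX≢lineY

    line-splits-∞ : X ∈ c₂° → line X ≢ line Y → Y ≢ ∞ → ∃[ z ] z ∈ touching × Splits z ∞ Y
    line-splits-∞ {X} X∈c₂° lineX≢lineY Y≢∞ = let touches = line-touches X∈c₂° in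
      line X , ∈⟪⟫⁺ touches? touches , inj₁ (proj₁ touches , ∉line (inj₂ touches) lineX≢lineY Y≢∞)

    touching-splits-∞ : ∀ {X₁ X₂} → X₁ ∈ c₂° → X₂ ∈ c₂° → X₁ ≢ X₂ → Y ≢ ∞ →
      ∃[ z ] z ∈ touching × Splits z ∞ Y
    touching-splits-∞ {Y} {X₁} {X₂} X₁∈c₂° X₂∈c₂° X₁≢X₂ Y≢∞ with line X₁ ≟ line Y
    ... | no  lineX₁≢lineY = line-splits-∞ X₁∈c₂° lineX₁≢lineY Y≢∞
    ... | yes lineX₁≡lineY = line-splits-∞ X₂∈c₂° lineX₂≢lineY Y≢∞
      where
      lineX₂≢lineY : line X₂ ≢ line Y
      lineX₂≢lineY lineX₂≡lineY =
        let (X₁∈c₂ , X₁≢∞ , _) = ∈c₂°⁻ X₁∈c₂° ; (X₂∈c₂ , X₂≢∞ , _) = ∈c₂°⁻ X₂∈c₂°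
        in X₁≢X₂ (line-injective-on-c₂ X₁∈c₂ X₂∈c₂ X₁≢∞ X₂≢∞ (trans lineX₁≡lineY (sym lineX₂≡lineY)))

  module TwoPencils (fr : Frame) where
    open Frame fr
    module P₁ = Pencil fr
    module P₂ = Pencil (swap fr)

    ¬inBothPencils : P₁.InPencil z → P₂.InPencil z → ⊥
    ¬inBothPencils (inj₁ refl)      (inj₁ c₁≡c₂)         = c₁≢c₂ c₁≡c₂
    ¬inBothPencils (inj₁ refl)      (inj₂ touches₂)      = P₂.A∉touching touches₂ A∈c₁
    ¬inBothPencils (inj₂ touches₁)  (inj₁ refl)          = P₁.A∉touching touches₁ A∈c₂
    ¬inBothPencils (inj₂ touches₁)  (inj₂ (_ , z∩c₂⊆∞)) = P₁.touching⇒¬touches-c₂ touches₁ z∩c₂⊆∞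

    lines-differ : X ≢ Y → X ≢ ∞ → Y ≢ ∞ → P₁.line X ≡ P₁.line Y → P₂.line X ≢ P₂.line Y
    lines-differ {X} {Y} X≢Y X≢∞ Y≢∞ line₁X≡line₁Y line₂X≡line₂Y =
      ¬inBothPencils (P₁.line∈pencil X) (subst P₂.InPencil (sym line₁X≡line₂X) (P₂.line∈pencil X))
      where
      line₁X≡line₂X : P₁.line X ≡ P₂.line X
      line₁X≡line₂X = circle-unique (X≢∞ ∘ sym) (Y≢∞ ∘ sym) X≢Y
        (P₁.InPencil⇒∞∈ (P₁.line∈pencil X)) (P₁.∈line X) (P₁.line≡⇒∈line {X} line₁X≡line₁Y)
        (P₂.InPencil⇒∞∈ (P₂.line∈pencil X)) (P₂.∈line X) (P₂.line≡⇒∈line {X} line₂X≡line₂Y)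

    touching : Subset nZ
    touching = P₁.touching ∪ P₂.touching

    private
      in₁ : ∀ {Q : Fin nZ → Set} → ∃[ z ] z ∈ P₁.touching × Q z → ∃[ z ] z ∈ touching × Q z
      in₁ = map₂ (map₁ (x∈p∪q⁺ ∘ inj₁))
      in₂ : ∀ {Q : Fin nZ → Set} → ∃[ z ] z ∈ P₂.touching × Q z → ∃[ z ] z ∈ touching × Q z
      in₂ = map₂ (map₁ (x∈p∪q⁺ ∘ inj₂))

    touching-splitting : ∀ {X₁ X₂} → X₁ ∈ P₁.c₂° → X₂ ∈ P₁.c₂° → X₁ ≢ X₂ → Splitting touching
    touching-splitting X₁∈c₂° X₂∈c₂° X₁≢X₂ X Y X≢Y with X ≟ ∞ | Y ≟ ∞
    ... | yes refl | yes refl = contradiction refl X≢Y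
    ... | yes refl | no  Y≢∞ = in₁ (P₁.touching-splits-∞ X₁∈c₂° X₂∈c₂° X₁≢X₂ Y≢∞)
    ... | no  X≢∞ | yes refl = map₂ (map₂ Splits-sym) (in₁ (P₁.touching-splits-∞ X₁∈c₂° X₂∈c₂° X₁≢X₂ X≢∞))
    ... | no  X≢∞ | no  Y≢∞ with P₁.line X ≟ P₁.line Y | P₂.line X ≟ P₂.line Y
    ...   | no  line₁X≢line₁Y | _                 = in₁ (P₁.touching-splits X≢∞ Y≢∞ line₁X≢line₁Y)
    ...   | yes _              | no line₂X≢line₂Y = in₂ (P₂.touching-splits X≢∞ Y≢∞ line₂X≢line₂Y)
    ...   | yes line₁X≡line₁Y | yes line₂X≡line₂Y = contradiction line₂X≡line₂Y (lines-differ X≢Y X≢∞ Y≢∞ line₁X≡line₁Y)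

module Counting {nP nZ : ℕ} (M : MoebiusPlane nP nZ) (q : ℕ) (order : HasOrder M q) where
  open MoebiusPlane M
  open Incidence M

  private variable
    X Y : Fin nP
    z z′ : Fin nZ

  module _ (fr : Frame) where
    open Frame fr
    open Pencil fr

    ∣c₂-∞∣≡q : ∣ circle c₂ - ∞ ∣ ≡ q
    ∣c₂-∞∣≡q = suc-injective (trans (sym (∣p∣≡1+∣p-x∣ ∞∈c₂)) (order c₂))

    1+∣c₂°∣≡q : suc ∣ c₂° ∣ ≡ q
    1+∣c₂°∣≡q = trans (sym (∣p∣≡1+∣p-x∣ (x∈p∧x≢y⇒x∈p-y A∈c₂ (∞≢A ∘ sym)))) ∣c₂-∞∣≡q

    ∣touching∣<q : ∣ touching ∣ < q
    ∣touching∣<q = subst (∣ touching ∣ <_) 1+∣c₂°∣≡q (s≤s (injective⇒∣p∣≤∣r∣ meet meet∈c₂° meet-injective))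
      where
      meet : z ∈ touching → Fin nP
      meet z∈touching = proj₁ (touching-meets-c₂ (∈⟪⟫⁻ touches? z∈touching))
      meet∈c₂° : (z∈touching : z ∈ touching) → meet z∈touching ∈ c₂°
      meet∈c₂° z∈touching =
        let touches = ∈⟪⟫⁻ touches? z∈touching
            (X , X∈z , X∈c₂ , X≢∞) = touching-meets-c₂ touches
        in x∈p∧x≢y⇒x∈p-y (x∈p∧x≢y⇒x∈p-y X∈c₂ X≢∞) λ X≡A → A∉touching touches (subst (λ Y → Y ∈ circle _) X≡A X∈z)
      meet-injective : (z∈touching : z ∈ touching) (z′∈touching : z′ ∈ touching) → meet z∈touching ≡ meet z′∈touching → z ≡ z′
      meet-injective z∈touching z′∈touching meets≡ =
        let touches = ∈⟪⟫⁻ touches? z∈touching ; touches′ = ∈⟪⟫⁻ touches? z′∈touching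
            (_ , X∈z , _ , X≢∞) = touching-meets-c₂ touches
            (_ , X′∈z′ , _ , X′≢∞) = touching-meets-c₂ touches′
        in trans (line-unique (inj₂ touches) X∈z X≢∞)
                 (trans (cong line meets≡) (sym (line-unique (inj₂ touches′) X′∈z′ X′≢∞)))

    q≤∣pencil∣ : q ≤ ∣ pencil ∣
    q≤∣pencil∣ = subst (_≤ ∣ pencil ∣) ∣c₂-∞∣≡q
      (injective⇒∣p∣≤∣r∣ (λ {X} _ → line X) (λ {X} _ → ∈⟪⟫⁺ inPencil? (line∈pencil X))
        λ X∈c₂-∞ Y∈c₂-∞ → let (X∈c₂ , X≢∞) = x∈p-y⁻ X∈c₂-∞ ; (Y∈c₂ , Y≢∞) = x∈p-y⁻ Y∈c₂-∞
                          in line-injective-on-c₂ X∈c₂ Y∈c₂ X≢∞ Y≢∞)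

  q*q<nP : q * q < nP
  q*q<nP = begin-strict
    q * q                  ≤⟨ *-monoʳ-≤ q (q≤∣pencil∣ someFrame) ⟩
    q * ∣ pencil ∣         ≤⟨ +-cancelˡ-≤ ∣ pencil ∣ _ _ double-count ⟩
    ∣ others ∣             <⟨ ≤-refl ⟩
    suc ∣ others ∣         ≡⟨ sym (∣p∣≡1+∣p-x∣ (∈⊤ {x = ∞})) ⟩
    ∣ ⊤ {nP} ∣             ≡⟨ ∣⊤∣≡n nP ⟩
    nP                     ∎
    where
    open Frame someFrame
    open Pencil someFrame
    open ≤-Reasoning
    others : Subset nP
    others = ⊤ - ∞
    χ : Subset nP → Fin nP → ℕ
    χ p X = indicator (lookup p X)
    pencil-degree≤ : ∀ X → ∣ pencil ∩ dual circle X ∣ ≤ χ others X + χ ⁅ ∞ ⁆ X * ∣ pencil ∣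
    pencil-degree≤ X with X ≟ ∞
    ... | yes refl rewrite []=⇒lookup (x∈⁅x⁆ ∞) =
      ≤-trans (∣p∩q∣≤∣p∣ pencil (dual circle ∞)) (≤-trans (m≤m+n ∣ pencil ∣ 0) (m≤n+m _ (χ others ∞)))
    ... | no X≢∞ rewrite []=⇒lookup (x∈p∧x≢y⇒x∈p-y (∈⊤ {x = X}) X≢∞) =
      ≤-trans (all-equal⇒∣p∣≤1 λ z∈ z′∈ → trans (on-line z∈) (sym (on-line z′∈))) (m≤m+n 1 _)
      where
      on-line : z ∈ pencil ∩ dual circle X → z ≡ line X
      on-line z∈ = let (z∈pencil , z∈dual) = x∈p∩q⁻ pencil _ z∈
                   in line-unique (∈⟪⟫⁻ inPencil? z∈pencil) (∈dual⁻ {block = circle} z∈dual) X≢∞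
    double-count : ∣ pencil ∣ + q * ∣ pencil ∣ ≤ ∣ pencil ∣ + ∣ others ∣
    double-count = begin
      ∣ pencil ∣ + q * ∣ pencil ∣                              ≡⟨ cong (∣ pencil ∣ +_) (*-comm q ∣ pencil ∣) ⟩
      ∣ pencil ∣ + ∣ pencil ∣ * q                              ≡⟨ sym (*-suc ∣ pencil ∣ q) ⟩
      ∣ pencil ∣ * suc q                                       ≡⟨ sym (∑∣S∩dual∣≡∣S∣*k pencil circle order) ⟩
      ∑[ X < nP ] ∣ pencil ∩ dual circle X ∣                  ≤⟨ ∑-mono-≤ pencil-degree≤ ⟩
      ∑[ X < nP ] (χ others X + χ ⁅ ∞ ⁆ X * ∣ pencil ∣)      ≡⟨ ∑-distrib-+ (χ others) _ ⟩
      ∑[ X < nP ] χ others X + ∑[ X < nP ] (χ ⁅ ∞ ⁆ X * ∣ pencil ∣)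
                                                               ≡⟨ cong₂ _+_ (sym (∣p∣≡∑ others)) (sym (*-distribʳ-sum ∣ pencil ∣ (χ ⁅ ∞ ⁆))) ⟩
      ∣ others ∣ + (∑[ X < nP ] χ ⁅ ∞ ⁆ X) * ∣ pencil ∣       ≡⟨ cong (λ k → ∣ others ∣ + k * ∣ pencil ∣) (trans (sym (∣p∣≡∑ ⁅ ∞ ⁆)) (∣⁅x⁆∣≡1 ∞)) ⟩
      ∣ others ∣ + (∣ pencil ∣ + 0)                            ≡⟨ cong (∣ others ∣ +_) (+-identityʳ ∣ pencil ∣) ⟩
      ∣ others ∣ + ∣ pencil ∣                                  ≡⟨ +-comm ∣ others ∣ ∣ pencil ∣ ⟩
      ∣ pencil ∣ + ∣ others ∣                                  ∎

  module _ {S : Subset nZ} (splitting : Splitting S) where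

    degree : Fin nP → ℕ
    degree X = ∣ S ∩ dual circle X ∣

    ∈S∩dual : z ∈ S → X ∈ circle z → z ∈ S ∩ dual circle X
    ∈S∩dual z∈S X∈z = x∈p∩q⁺ (z∈S , ∈dual⁺ {block = circle} X∈z)

    isolated pendant : Subset nP
    isolated = ⟪ (λ X → degree X ≟ℕ 0) ⟫
    pendant  = ⟪ (λ X → degree X ≟ℕ 1) ⟫

    ∣isolated∣≤1 : ∣ isolated ∣ ≤ 1
    ∣isolated∣≤1 = all-equal⇒∣p∣≤1 λ {X} {Y} X∈isolated Y∈isolated → decidable-stable (X ≟ Y) λ X≢Y →
      let (z , z∈S , splits) = splitting X Y X≢Y
      in [ (λ (X∈z , _) → off X∈isolated z∈S X∈z) , (λ (_ , Y∈z) → off Y∈isolated z∈S Y∈z) ] splits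
      where
      off : X ∈ isolated → z ∈ S → X ∉ circle z
      off X∈isolated z∈S X∈z = >⇒≢ (x∈p⇒0<∣p∣ (∈S∩dual z∈S X∈z)) (∈⟪⟫⁻ (λ X → degree X ≟ℕ 0) X∈isolated)

    pendant-circle : X ∈ pendant → ∃[ z ] z ∈ S × X ∈ circle z
    pendant-circle X∈pendant =
      let (z , z∈S∩dual) = 0<∣p∣⇒Nonempty (subst (0 <_) (sym (∈⟪⟫⁻ (λ X → degree X ≟ℕ 1) X∈pendant)) (s≤s z≤n))
          (z∈S , z∈dual) = x∈p∩q⁻ S _ z∈S∩dual
      in z , z∈S , ∈dual⁻ {block = circle} z∈dual

    pendant-circle-unique : X ∈ pendant → z ∈ S → z′ ∈ S → X ∈ circle z → X ∈ circle z′ → z ≡ z′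
    pendant-circle-unique {z = z} {z′} X∈pendant z∈S z′∈S X∈z X∈z′ = decidable-stable (z ≟ z′) λ z≢z′ →
      >⇒≢ (x∈p⇒y∈p⇒x≢y⇒1<∣p∣ (∈S∩dual z∈S X∈z) (∈S∩dual z′∈S X∈z′) z≢z′)
          (∈⟪⟫⁻ (λ X → degree X ≟ℕ 1) X∈pendant)

    pendant-unsplit : ∀ {c} → X ∈ pendant → c ∈ S → X ∈ circle c → Y ∈ circle c → z ∈ S → X ∈ circle z → Y ∈ circle z
    pendant-unsplit {Y = Y} X∈pendant c∈S X∈c Y∈c z∈S X∈z =
      subst (λ w → Y ∈ circle w) (pendant-circle-unique X∈pendant c∈S z∈S X∈c X∈z) Y∈c

    ∣pendant∣≤∣S∣ : ∣ pendant ∣ ≤ ∣ S ∣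
    ∣pendant∣≤∣S∣ = injective⇒∣p∣≤∣r∣ (proj₁ ∘ pendant-circle) (proj₁ ∘ proj₂ ∘ pendant-circle) same-circle⇒≡
      where
      -- A circle of S splitting X and Y would be a second circle of S through one of them.
      same-circle⇒≡ : (X∈pendant : X ∈ pendant) (Y∈pendant : Y ∈ pendant) →
        proj₁ (pendant-circle X∈pendant) ≡ proj₁ (pendant-circle Y∈pendant) → X ≡ Y
      same-circle⇒≡ {X} {Y} X∈pendant Y∈pendant same = decidable-stable (X ≟ Y) λ X≢Y →
        let (c , c∈S , X∈c) = pendant-circle X∈pendant
            Y∈c = subst (λ w → Y ∈ circle w) (sym same) (proj₂ (proj₂ (pendant-circle Y∈pendant)))
            (z , z∈S , splits) = splitting X Y X≢Y
        in [ (λ (X∈z , Y∉z) → Y∉z (pendant-unsplit X∈pendant c∈S X∈c Y∈c z∈S X∈z))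
           , (λ (X∉z , Y∈z) → X∉z (pendant-unsplit Y∈pendant c∈S Y∈c X∈c z∈S Y∈z)) ] splits

    2*nP≤∣S∣*[q+2]+2 : 2 * nP ≤ ∣ S ∣ * (q + 2) + 2
    2*nP≤∣S∣*[q+2]+2 = begin
      2 * nP                                            ≡⟨ *-comm 2 nP ⟩
      nP * 2                                            ≡⟨ sym (∑-const nP 2) ⟩
      ∑[ X < nP ] 2                                     ≤⟨ ∑-mono-≤ (λ X → 2≤d+deficit[d] (degree X)) ⟩
      ∑[ X < nP ] (degree X + deficit (degree X))       ≡⟨ ∑-distrib-+ degree (deficit ∘ degree) ⟩
      ∑[ X < nP ] degree X + ∑[ X < nP ] deficit (degree X)
                                                        ≡⟨ cong₂ _+_ (∑∣S∩dual∣≡∣S∣*k S circle order) ∑deficit ⟩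
      ∣ S ∣ * suc q + (2 * ∣ isolated ∣ + ∣ pendant ∣) ≤⟨ +-monoʳ-≤ (∣ S ∣ * suc q) (+-mono-≤ (*-monoʳ-≤ 2 ∣isolated∣≤1) ∣pendant∣≤∣S∣) ⟩
      ∣ S ∣ * suc q + (2 * 1 + ∣ S ∣)                  ≡⟨ regroup ∣ S ∣ q ⟩
      ∣ S ∣ * (q + 2) + 2                               ∎
      where
      open ≤-Reasoning
      χ : Subset nP → Fin nP → ℕ
      χ p X = indicator (lookup p X)
      regroup : ∀ k q → k * suc q + (2 * 1 + k) ≡ k * (q + 2) + 2
      regroup = solve-∀
      ∑deficit : ∑[ X < nP ] deficit (degree X) ≡ 2 * ∣ isolated ∣ + ∣ pendant ∣
      ∑deficit = begin-equality
        ∑[ X < nP ] deficit (degree X)                          ≡⟨ sum-cong-≗ (λ X → sym (cong₂ (λ a b → 2 * indicator a + indicator b)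
                                                                     (lookup-⟪⟫ (λ X → degree X ≟ℕ 0) X) (lookup-⟪⟫ (λ X → degree X ≟ℕ 1) X))) ⟩
        ∑[ X < nP ] (2 * χ isolated X + χ pendant X)            ≡⟨ ∑-distrib-+ (λ X → 2 * χ isolated X) (χ pendant) ⟩
        ∑[ X < nP ] (2 * χ isolated X) + ∑[ X < nP ] χ pendant X ≡⟨ cong₂ _+_ (sym (*-distribˡ-sum 2 (χ isolated))) (sym (∣p∣≡∑ pendant)) ⟩
        2 * ∑[ X < nP ] χ isolated X + ∣ pendant ∣             ≡⟨ cong (λ k → 2 * k + ∣ pendant ∣) (sym (∣p∣≡∑ isolated)) ⟩
        2 * ∣ isolated ∣ + ∣ pendant ∣                          ∎

  splitting⇒2*q*q≤∣S∣*[q+2] : ∀ {S} → Splitting S → 2 * (q * q) ≤ ∣ S ∣ * (q + 2)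
  splitting⇒2*q*q≤∣S∣*[q+2] {S} splitting = +-cancelˡ-≤ 2 _ _ (begin
    2 + 2 * (q * q)      ≡⟨ sym (*-suc 2 (q * q)) ⟩
    2 * suc (q * q)      ≤⟨ *-monoʳ-≤ 2 q*q<nP ⟩
    2 * nP               ≤⟨ 2*nP≤∣S∣*[q+2]+2 splitting ⟩
    ∣ S ∣ * (q + 2) + 2  ≡⟨ +-comm (∣ S ∣ * (q + 2)) 2 ⟩
    2 + ∣ S ∣ * (q + 2)  ∎)
    where open ≤-Reasoning

  open TwoPencils someFrame using (touching; touching-splitting)

  3≤q⇒touching-splitting : 3 ≤ q → Splitting touching
  3≤q⇒touching-splitting 3≤q =
    let 2≤∣c₂°∣ = ≤-pred (subst (3 ≤_) (sym (1+∣c₂°∣≡q someFrame)) 3≤q)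
        (X₁ , X₁∈c₂°) = 0<∣p∣⇒Nonempty (≤-trans (s≤s z≤n) 2≤∣c₂°∣)
        (X₂ , X₂∈c₂°-X₁) = 0<∣p∣⇒Nonempty (≤-pred (subst (2 ≤_) (∣p∣≡1+∣p-x∣ X₁∈c₂°) 2≤∣c₂°∣))
        (X₂∈c₂° , X₂≢X₁) = x∈p-y⁻ X₂∈c₂°-X₁
    in touching-splitting X₁∈c₂° X₂∈c₂° (X₂≢X₁ ∘ sym)

  ∣touching∣≤2q∸2 : ∣ touching ∣ ≤ 2 * q ∸ 2
  ∣touching∣≤2q∸2 = ≤-trans (∣p∪r∣≤∣p∣+∣r∣ (Pencil.touching someFrame) (Pencil.touching (swap someFrame)))
    (m<o⇒n<o⇒m+n≤2o∸2 (∣touching∣<q someFrame) (∣touching∣<q (swap someFrame)))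

mainTheorem5 : ∀ {nP nZ : ℕ} (M : MoebiusPlane nP nZ) (q : ℕ) → HasOrder M q →
    (SP : Subset nP) (SZ : Subset nZ) → MinSplitResolving M SP SZ →
    (5 < q → (2 * q ∸ 3 ≤ ∣ SZ ∣) × (∣ SZ ∣ ≤ 2 * q ∸ 2)) ×
    (3 ≤ q → q ≤ 5 → ∣ SZ ∣ ≡ 2 * q ∸ 2)
mainTheorem5 M q order SP SZ ((pointsResolveCircles , circlesResolvePoints) , minimal) =
  (λ 5<q → 2q∸j≤k 3 lower (4q<4[q+2] q) , upper (≤-trans (s≤s (s≤s (s≤s z≤n))) 5<q)) ,
  (λ 3≤q q≤5 → ≤-antisym (upper 3≤q) (2q∸j≤k 2 lower (q≤5⇒4q<3[q+2] q≤5)))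
  where
  open Incidence M
  open Counting M q order
  open TwoPencils someFrame using (touching)
  lower : 2 * (q * q) ≤ ∣ SZ ∣ * (q + 2)
  lower = splitting⇒2*q*q≤∣S∣*[q+2] λ X Y X≢Y → map₂ (map₂ separates⇒splits) (circlesResolvePoints X Y X≢Y)
  upper : 3 ≤ q → ∣ SZ ∣ ≤ 2 * q ∸ 2
  upper 3≤q = ≤-trans (+-cancelˡ-≤ ∣ SP ∣ _ _ (minimal SP touching resolving)) ∣touching∣≤2q∸2
    where
    resolving : SplitResolving M SP touching
    resolving = pointsResolveCircles , λ X Y X≢Y → map₂ (map₂ splits⇒separates) (3≤q⇒touching-splitting 3≤q X Y X≢Y)
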